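{- Let $k,m\ge 1$ and $n\ge 0$ be integers. The number of $(k,m)$-ary trees of order $n$ equals $$C_{k,m}(n):=\frac{1}{mn+1}\binom{(mn+1)k}{n}.$$
   Context: All trees are unlabelled plane trees: rooted trees whose vertices are indistinguishable but in which the children of each vertex are linearly ordered. The degree of a vertex is its number of children. A vertex is on level $j$ if its distance to the root is $j$ (the root is on level $0$). For $k,m\ge 1$ and $n\ge 0$, a $(k,m)$-ary tree of order $n$ is a plane tree such that (1) every vertex on an even level has degree exactly $k$, and (2) every vertex on an odd level has degree $m$ or $0$, and exactly $n$ vertices (necessarily on odd levels) have degree $m$. -}

module Defs where

open import Data.Nat using (ℕ; zero; suc; _+_; _*_)
open import Data.List using (List; []; _∷_; length)
open import Data.List.Relation.Unary.All using (All)
open import Data.Sum using (_⊎_)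
open import Data.Product using (_×_)
open import Relation.Binary.PropositionalEquality using (_≡_)

-- Unlabelled plane (ordered) rooted trees: a vertex is given by the
-- ordered list of its children.
data Tree : Set where
  node : List Tree → Tree

degree : Tree → ℕ
degree (node ts) = length ts

-- Shape conditions (1) and (2): EvenOK k m t says that t, rooted at a
-- vertex on an even level, has every even-level vertex of degree k and
-- every odd-level vertex of degree m or 0; OddOK the same for a subtree
-- whose root lies on an odd level.
mutual
  data EvenOK (k m : ℕ) : Tree → Set where
    even-node : ∀ {ts} → length ts ≡ k → All (OddOK k m) ts → EvenOK k m (node ts)

  data OddOK (k m : ℕ) : Tree → Set where
    odd-node : ∀ {ts} → (length ts ≡ m ⊎ length ts ≡ 0) → All (EvenOK k m) ts →
               OddOK k m (node ts)

-- Number of vertices on odd levels having degree exactly m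
-- (in a subtree whose root is on an even / odd level respectively).
mutual
  oddDegCountE : ℕ → Tree → ℕ
  oddDegCountE m (node ts) = oddDegCountOs m ts

  oddDegCountOs : ℕ → List Tree → ℕ
  oddDegCountOs m [] = 0
  oddDegCountOs m (t ∷ ts) = oddDegCountO m t + oddDegCountOs m ts

  oddDegCountO : ℕ → Tree → ℕ
  oddDegCountO m (node ts) = isEq m (length ts) + oddDegCountEs m ts

  oddDegCountEs : ℕ → List Tree → ℕ
  oddDegCountEs m [] = 0
  oddDegCountEs m (t ∷ ts) = oddDegCountE m t + oddDegCountEs m ts

  isEq : ℕ → ℕ → ℕ
  isEq zero zero = 1
  isEq zero (suc b) = 0
  isEq (suc a) zero = 0
  isEq (suc a) (suc b) = isEq a b

IsKMTree : ℕ → ℕ → ℕ → Tree → Set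
IsKMTree k m n t = EvenOK k m t × oddDegCountE m t ≡ n

-- Cut a (k,m)-ary tree below its root: it is a forest of k subtrees rooted on odd
-- levels.  Let L(n,r) count such forests of r trees with n vertices of degree m.
-- The first tree of a forest is either a leaf, or an m-node whose m children have k
-- children each; replacing that m-node by its mk grandchildren is a bijection onto
-- forests of r-1+mk trees with one m-node fewer.  Hence L(0,r) = 1, L(n+1,0) = 0 and
-- L(n+1,r+1) = L(n+1,r) + L(n,r+mk), whose solution is the Raney number
-- L(n,r) = r/(mkn+r) * binom(mkn+r, n); at r = k this is 1/(mn+1) * binom((mn+1)k, n).
module Submission where

open import Defs
open import Data.Nat using (ℕ; zero; suc; _+_; _*_; _≤_; _≥_; _∸_; z≤n; s≤s)
open import Data.Nat.Properties
open import Data.Nat.Combinatorics using (_C_; nC1≡n; nCk+nC[k+1]≡[n+1]C[k+1]; k>n⇒nCk≡0)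
open import Data.Nat.Tactic.RingSolver using (solve-∀)
open import Data.List using (List; []; _∷_; length; _++_; map; take; drop)
open import Data.List.Properties using (length-++; length-take; length-drop; take++drop≡id; ++-assoc; ∷-injectiveʳ; length-map)
open import Data.List.Membership.Propositional using (_∈_)
open import Data.List.Membership.Propositional.Properties using (∈-map⁻; ∈-map⁺; ∈-++⁺ˡ; ∈-++⁺ʳ)
open import Data.List.Relation.Unary.Any using (here)
open import Data.List.Relation.Unary.All as All using (All; []; _∷_)
open import Data.List.Relation.Unary.All.Properties using (++⁺; ++⁻ˡ; ++⁻ʳ; gmap⁺)
open import Data.List.Relation.Unary.Unique.Propositional using (Unique)
import Data.List.Relation.Unary.Unique.Propositional.Properties as Unique
open import Data.List.Relation.Unary.AllPairs using ([]; _∷_)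
open import Data.Product using (Σ; _×_; _,_; proj₁; proj₂)
open import Data.Sum using (inj₁; inj₂)
open import Data.Empty using (⊥; ⊥-elim)
open import Function.Bundles using (_⇔_; mk⇔; Equivalence)
open import Relation.Binary.PropositionalEquality

open ≡-Reasoning

[k+1]*[n+1]C[k+1]≡[n+1]*nCk : ∀ n k → suc k * (suc n C suc k) ≡ suc n * (n C k)
[k+1]*[n+1]C[k+1]≡[n+1]*nCk zero zero = refl
[k+1]*[n+1]C[k+1]≡[n+1]*nCk zero (suc k) =
  trans (cong (suc (suc k) *_) (k>n⇒nCk≡0 (s≤s (s≤s (z≤n {k}))))) (*-zeroʳ (suc (suc k)))
[k+1]*[n+1]C[k+1]≡[n+1]*nCk (suc n) zero =
  trans (+-identityʳ _) (trans (nC1≡n (suc (suc n))) (sym (*-identityʳ _)))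
[k+1]*[n+1]C[k+1]≡[n+1]*nCk (suc n) (suc k) = begin
  suc (suc k) * (suc (suc n) C suc (suc k))
    ≡⟨ cong (suc (suc k) *_) (nCk+nC[k+1]≡[n+1]C[k+1] (suc n) (suc k)) ⟨
  suc (suc k) * (suc n C suc k + suc n C suc (suc k))
    ≡⟨ distrib (suc n C suc k) (suc n C suc (suc k)) ⟩
  suc n C suc k + suc k * (suc n C suc k) + suc (suc k) * (suc n C suc (suc k))
    ≡⟨ cong₂ (λ x y → suc n C suc k + x + y)
         ([k+1]*[n+1]C[k+1]≡[n+1]*nCk n k) ([k+1]*[n+1]C[k+1]≡[n+1]*nCk n (suc k)) ⟩
  suc n C suc k + suc n * (n C k) + suc n * (n C suc k)
    ≡⟨ collect (suc n C suc k) (n C k) (n C suc k) ⟩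
  suc n C suc k + suc n * (n C k + n C suc k)
    ≡⟨ cong (λ x → suc n C suc k + suc n * x) (nCk+nC[k+1]≡[n+1]C[k+1] n k) ⟩
  suc (suc n) * (suc n C suc k) ∎
  where
  distrib : ∀ x y → suc (suc k) * (x + y) ≡ x + suc k * x + suc (suc k) * y
  distrib = solve-∀
  collect : ∀ x y z → x + suc n * y + suc n * z ≡ x + suc n * (y + z)
  collect = solve-∀

module Raney (q : ℕ) (L : ℕ → ℕ → ℕ)
  (L-zero : ∀ r → L 0 r ≡ 1)
  (L-suc-zero : ∀ n → L (suc n) 0 ≡ 0)
  (L-suc-suc : ∀ n r → L (suc n) (suc r) ≡ L (suc n) r + L n (r + suc q))
  where

  p : ℕ
  p = suc q

  top : ℕ → ℕ → ℕ
  top n r = q + p * n + r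

  suc-top : ∀ n r → suc (top n r) ≡ p * suc n + r
  suc-top = general q
    where
    general : ∀ q n r → suc (q + suc q * n + r) ≡ suc q * suc n + r
    general = solve-∀

  L-one : ∀ r → L 1 r ≡ r
  L-one zero    = L-suc-zero 0
  L-one (suc r) = begin
    L 1 (suc r)          ≡⟨ L-suc-suc 0 r ⟩
    L 1 r + L 0 (r + p)  ≡⟨ cong₂ _+_ (L-one r) (L-zero (r + p)) ⟩
    r + 1                ≡⟨ +-comm r 1 ⟩
    suc r                ∎

  -- L(n+1,r) = binom(p(n+1)+r, n+1) - p * binom(p(n+1)+r-1, n), kept free of subtraction.
  L[1+n,r]+p*topCn≡[1+top]C[1+n] : ∀ n r → L (suc n) r + p * (top n r C n) ≡ suc (top n r) C suc n
  L[1+n,r]+p*topCn≡[1+top]C[1+n] zero r = begin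
    L 1 r + p * 1       ≡⟨ cong (_+ p * 1) (L-one r) ⟩
    r + p * 1           ≡⟨ +-comm r (p * 1) ⟩
    p * 1 + r           ≡⟨ suc-top 0 r ⟨
    suc (top 0 r)       ≡⟨ nC1≡n (suc (top 0 r)) ⟨
    suc (top 0 r) C 1   ∎
  L[1+n,r]+p*topCn≡[1+top]C[1+n] (suc n) zero = begin
    L (suc (suc n)) 0 + p * (N C suc n)  ≡⟨ cong (_+ p * (N C suc n)) (L-suc-zero (suc n)) ⟩
    p * (N C suc n)                      ≡⟨ *-cancelˡ-≡ _ _ (suc (suc n)) absorbed ⟨
    suc N C suc (suc n)                  ∎
    where
    N = top (suc n) 0
    absorbed : suc (suc n) * (suc N C suc (suc n)) ≡ suc (suc n) * (p * (N C suc n))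
    absorbed = begin
      suc (suc n) * (suc N C suc (suc n))  ≡⟨ [k+1]*[n+1]C[k+1]≡[n+1]*nCk N (suc n) ⟩
      suc N * (N C suc n)                  ≡⟨ cong (_* (N C suc n)) (suc-top (suc n) 0) ⟩
      (p * suc (suc n) + 0) * (N C suc n)  ≡⟨ reorder p (suc (suc n)) (N C suc n) ⟩
      suc (suc n) * (p * (N C suc n))      ∎
      where
      reorder : ∀ a b c → (a * b + 0) * c ≡ b * (a * c)
      reorder = solve-∀
  L[1+n,r]+p*topCn≡[1+top]C[1+n] (suc n) (suc r) = begin
    L (suc (suc n)) (suc r) + p * (top (suc n) (suc r) C suc n)
      ≡⟨ cong (λ t → L (suc (suc n)) (suc r) + p * (t C suc n)) (+-suc (q + p * suc n) r) ⟩
    L (suc (suc n)) (suc r) + p * (suc M C suc n)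
      ≡⟨ cong₂ (λ x y → x + p * y) (L-suc-suc (suc n) r) (sym (nCk+nC[k+1]≡[n+1]C[k+1] M n)) ⟩
    (L (suc (suc n)) r + L (suc n) (r + p)) + p * (M C n + M C suc n)
      ≡⟨ regroup (L (suc (suc n)) r) (L (suc n) (r + p)) (M C n) (M C suc n) ⟩
    (L (suc (suc n)) r + p * (M C suc n)) + (L (suc n) (r + p) + p * (M C n))
      ≡⟨ cong₂ _+_ (L[1+n,r]+p*topCn≡[1+top]C[1+n] (suc n) r) shifted ⟩
    suc M C suc (suc n) + suc M C suc n
      ≡⟨ +-comm (suc M C suc (suc n)) _ ⟩
    suc M C suc n + suc M C suc (suc n)
      ≡⟨ nCk+nC[k+1]≡[n+1]C[k+1] (suc M) (suc n) ⟩
    suc (suc M) C suc (suc n)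
      ≡⟨ cong (λ t → suc t C suc (suc n)) (+-suc (q + p * suc n) r) ⟨
    suc (top (suc n) (suc r)) C suc (suc n) ∎
    where
    M = top (suc n) r
    regroup : ∀ a b c d → (a + b) + p * (c + d) ≡ (a + p * d) + (b + p * c)
    regroup = solve-∀
    same-top : ∀ q n r → q + suc q * n + (r + suc q) ≡ q + suc q * suc n + r
    same-top = solve-∀
    shifted : L (suc n) (r + p) + p * (M C n) ≡ suc M C suc n
    shifted = subst (λ t → L (suc n) (r + p) + p * (t C n) ≡ suc t C suc n)
                (same-top q n r) (L[1+n,r]+p*topCn≡[1+top]C[1+n] n (r + p))

  raney : ∀ n r → (p * n + r) * L n r ≡ r * ((p * n + r) C n)
  raney zero r = begin
    (p * 0 + r) * L 0 r  ≡⟨ cong₂ (λ x y → (x + r) * y) (*-zeroʳ p) (L-zero r) ⟩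
    r * 1                ∎
  raney (suc n) r = +-cancelʳ-≡ (p * (suc n * c)) _ _ (begin
    A * L (suc n) r + p * (suc n * c)  ≡⟨ cong (λ x → A * L (suc n) r + p * x) absorbed ⟩
    A * L (suc n) r + p * (A * x)      ≡⟨ factor A (L (suc n) r) p x ⟩
    A * (L (suc n) r + p * x)          ≡⟨ cong (A *_) L+p*x≡c ⟩
    A * c                              ≡⟨ expand p (suc n) r c ⟩
    r * c + p * (suc n * c)            ∎)
    where
    A = p * suc n + r
    x = top n r C n
    c = A C suc n
    L+p*x≡c : L (suc n) r + p * x ≡ c
    L+p*x≡c = trans (L[1+n,r]+p*topCn≡[1+top]C[1+n] n r) (cong (_C suc n) (suc-top n r))
    absorbed : suc n * c ≡ A * x
    absorbed = begin
      suc n * (A C suc n)              ≡⟨ cong (λ t → suc n * (t C suc n)) (suc-top n r) ⟨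
      suc n * (suc (top n r) C suc n)  ≡⟨ [k+1]*[n+1]C[k+1]≡[n+1]*nCk (top n r) n ⟩
      suc (top n r) * x                ≡⟨ cong (_* x) (suc-top n r) ⟩
      A * x                            ∎
    factor : ∀ a l p x → a * l + p * (a * x) ≡ a * (l + p * x)
    factor = solve-∀
    expand : ∀ p n r c → (p * n + r) * c ≡ r * c + p * (n * c)
    expand = solve-∀

leaf : Tree
leaf = node []

HasDegree : ℕ → Tree → Set
HasDegree k t = degree t ≡ k

concatChildren : List Tree → List Tree
concatChildren []             = []
concatChildren (node cs ∷ ts) = cs ++ concatChildren ts

length-concatChildren : ∀ {k} es → All (HasDegree k) es → length (concatChildren es) ≡ length es * k
length-concatChildren []             []         = refl
length-concatChildren (node cs ∷ es) (refl ∷ ds) =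
  trans (length-++ cs) (cong (length cs +_) (length-concatChildren es ds))

take-length-++ : ∀ {A : Set} (xs ys : List A) → take (length xs) (xs ++ ys) ≡ xs
take-length-++ []       ys = refl
take-length-++ (x ∷ xs) ys = cong (x ∷_) (take-length-++ xs ys)

drop-length-++ : ∀ {A : Set} (xs ys : List A) → drop (length xs) (xs ++ ys) ≡ ys
drop-length-++ []       ys = refl
drop-length-++ (x ∷ xs) ys = drop-length-++ xs ys

module Chunks (k : ℕ) where

  chunks : ℕ → List Tree → List Tree
  chunks zero    xs = []
  chunks (suc j) xs = node (take k xs) ∷ chunks j (drop k xs)

  leftover : ℕ → List Tree → List Tree
  leftover zero    xs = xs
  leftover (suc j) xs = leftover j (drop k xs)

  length-chunks : ∀ j xs → length (chunks j xs) ≡ j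
  length-chunks zero    xs = refl
  length-chunks (suc j) xs = cong suc (length-chunks j (drop k xs))

  concatChildren-chunks++leftover : ∀ j xs → concatChildren (chunks j xs) ++ leftover j xs ≡ xs
  concatChildren-chunks++leftover zero    xs = refl
  concatChildren-chunks++leftover (suc j) xs = begin
    (take k xs ++ concatChildren (chunks j (drop k xs))) ++ leftover j (drop k xs)
      ≡⟨ ++-assoc (take k xs) _ _ ⟩
    take k xs ++ (concatChildren (chunks j (drop k xs)) ++ leftover j (drop k xs))
      ≡⟨ cong (take k xs ++_) (concatChildren-chunks++leftover j (drop k xs)) ⟩
    take k xs ++ drop k xs
      ≡⟨ take++drop≡id k xs ⟩
    xs ∎

  chunks-hasDegree : ∀ j xs → j * k ≤ length xs → All (HasDegree k) (chunks j xs)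
  chunks-hasDegree zero    xs _  = []
  chunks-hasDegree (suc j) xs le =
    trans (length-take k xs) (m≤n⇒m⊓n≡m (m+n≤o⇒m≤o k le)) ∷
    chunks-hasDegree j (drop k xs) (subst (j * k ≤_) (sym (length-drop k xs)) rest)
    where
    rest : j * k ≤ length xs ∸ k
    rest = m+n≤o⇒m≤o∸n (j * k) (≤-trans (≤-reflexive (+-comm (j * k) k)) le)

  chunks-concatChildren : ∀ es ys → All (HasDegree k) es →
    chunks (length es) (concatChildren es ++ ys) ≡ es × leftover (length es) (concatChildren es ++ ys) ≡ ys
  chunks-concatChildren []             ys []         = refl , refl
  chunks-concatChildren (node cs ∷ es) ys (refl ∷ ds) =
    cong₂ _∷_ (cong node (trans (cong (take (length cs)) (++-assoc cs _ ys)) (take-length-++ cs _)))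
              (trans (cong (chunks (length es)) dropped) (proj₁ rec)) ,
    trans (cong (leftover (length es)) dropped) (proj₂ rec)
    where
    rec = chunks-concatChildren es ys ds
    dropped : drop (length cs) ((cs ++ concatChildren es) ++ ys) ≡ concatChildren es ++ ys
    dropped = trans (cong (drop (length cs)) (++-assoc cs _ ys)) (drop-length-++ cs _)

isEq-refl : ∀ m → isEq m m ≡ 1
isEq-refl zero    = refl
isEq-refl (suc m) = isEq-refl m

oddDegCountOs-++ : ∀ m xs ys → oddDegCountOs m (xs ++ ys) ≡ oddDegCountOs m xs + oddDegCountOs m ys
oddDegCountOs-++ m []       ys = refl
oddDegCountOs-++ m (x ∷ xs) ys =
  trans (cong (oddDegCountO m x +_) (oddDegCountOs-++ m xs ys)) (sym (+-assoc (oddDegCountO m x) _ _))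

oddDegCountOs-concatChildren : ∀ m es → oddDegCountOs m (concatChildren es) ≡ oddDegCountEs m es
oddDegCountOs-concatChildren m []             = refl
oddDegCountOs-concatChildren m (node cs ∷ es) =
  trans (oddDegCountOs-++ m cs _) (cong (oddDegCountOs m cs +_) (oddDegCountOs-concatChildren m es))

oddDegCountOs-node∷ : ∀ m cs ys → length cs ≡ m →
  oddDegCountOs m (node cs ∷ ys) ≡ suc (oddDegCountOs m (concatChildren cs ++ ys))
oddDegCountOs-node∷ m cs ys refl = begin
  isEq (length cs) (length cs) + oddDegCountEs m cs + oddDegCountOs m ys
    ≡⟨ cong (λ e → e + oddDegCountEs m cs + oddDegCountOs m ys) (isEq-refl (length cs)) ⟩
  suc (oddDegCountEs m cs + oddDegCountOs m ys)
    ≡⟨ cong (λ e → suc (e + oddDegCountOs m ys)) (oddDegCountOs-concatChildren m cs) ⟨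
  suc (oddDegCountOs m (concatChildren cs) + oddDegCountOs m ys)
    ≡⟨ cong suc (oddDegCountOs-++ m (concatChildren cs) ys) ⟨
  suc (oddDegCountOs m (concatChildren cs ++ ys)) ∎

module _ {k m : ℕ} where

  EvenOK⇒HasDegree : ∀ {t} → EvenOK k m t → HasDegree k t
  EvenOK⇒HasDegree (even-node d _) = d

  All-concatChildren⁺ : ∀ {es} → All (EvenOK k m) es → All (OddOK k m) (concatChildren es)
  All-concatChildren⁺ []                   = []
  All-concatChildren⁺ (even-node _ os ∷ es) = ++⁺ os (All-concatChildren⁺ es)

  All-concatChildren⁻ : ∀ es → All (HasDegree k) es → All (OddOK k m) (concatChildren es) → All (EvenOK k m) es
  All-concatChildren⁻ []             []       _  = []
  All-concatChildren⁻ (node cs ∷ es) (d ∷ ds) os =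
    even-node d (++⁻ˡ cs os) ∷ All-concatChildren⁻ es ds (++⁻ʳ cs os)

module Forests (k m-1 : ℕ) where

  open Chunks k

  m : ℕ
  m = suc m-1

  Forest : ℕ → ℕ → List Tree → Set
  Forest r n ts = length ts ≡ r × All (OddOK k m) ts × oddDegCountOs m ts ≡ n

  graft : List Tree → List Tree
  graft xs = node (chunks m xs) ∷ leftover m xs

  ungraft : List Tree → List Tree
  ungraft []            = []
  ungraft (node cs ∷ ys) = concatChildren cs ++ ys

  ungraft-graft : ∀ xs → ungraft (graft xs) ≡ xs
  ungraft-graft = concatChildren-chunks++leftover m

  graft-injective : ∀ {xs ys} → graft xs ≡ graft ys → xs ≡ ys
  graft-injective {xs} {ys} eq = begin
    xs                   ≡⟨ ungraft-graft xs ⟨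
    ungraft (graft xs)   ≡⟨ cong ungraft eq ⟩
    ungraft (graft ys)   ≡⟨ ungraft-graft ys ⟩
    ys                   ∎

  graft-ungraft : ∀ cs ys → length cs ≡ m → All (HasDegree k) cs → graft (ungraft (node cs ∷ ys)) ≡ node cs ∷ ys
  graft-ungraft cs ys e ds =
    subst (λ j → node (chunks j xs) ∷ leftover j xs ≡ node cs ∷ ys) e
      (cong₂ (λ gs zs → node gs ∷ zs) (proj₁ split) (proj₂ split))
    where
    xs = concatChildren cs ++ ys
    split = chunks-concatChildren cs ys ds

  Forest-leaf∷ : ∀ {r n ts} → Forest r n ts → Forest (suc r) n (leaf ∷ ts)
  Forest-leaf∷ (l , os , c) = cong suc l , odd-node (inj₂ refl) [] ∷ os , c

  length-ungraft : ∀ {cs ys} → length cs ≡ m → All (HasDegree k) cs →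
    length (ungraft (node cs ∷ ys)) ≡ length ys + m * k
  length-ungraft {cs} {ys} e ds = begin
    length (concatChildren cs ++ ys)           ≡⟨ length-++ (concatChildren cs) ⟩
    length (concatChildren cs) + length ys     ≡⟨ cong (_+ length ys) (length-concatChildren cs ds) ⟩
    length cs * k + length ys                  ≡⟨ cong (λ j → j * k + length ys) e ⟩
    m * k + length ys                          ≡⟨ +-comm (m * k) (length ys) ⟩
    length ys + m * k                          ∎

  Forest-node∷⇔ : ∀ {r n cs ys} → length cs ≡ m → All (HasDegree k) cs →
    Forest (suc r) (suc n) (node cs ∷ ys) ⇔ Forest (r + m * k) n (ungraft (node cs ∷ ys))
  Forest-node∷⇔ {r} {n} {cs} {ys} e ds = mk⇔ to from
    where
    to : Forest (suc r) (suc n) (node cs ∷ ys) → Forest (r + m * k) n (ungraft (node cs ∷ ys))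
    to (l , odd-node _ evens ∷ os , c) =
      trans (length-ungraft e ds) (cong (_+ m * k) (suc-injective l)) ,
      ++⁺ (All-concatChildren⁺ evens) os ,
      suc-injective (trans (sym (oddDegCountOs-node∷ m cs ys e)) c)
    from : Forest (r + m * k) n (ungraft (node cs ∷ ys)) → Forest (suc r) (suc n) (node cs ∷ ys)
    from (l , os , c) =
      cong suc (+-cancelʳ-≡ (m * k) _ _ (trans (sym (length-ungraft e ds)) l)) ,
      odd-node (inj₁ e) (All-concatChildren⁻ cs ds (++⁻ˡ _ os)) ∷ ++⁻ʳ _ os ,
      trans (oddDegCountOs-node∷ m cs ys e) (cong suc c)

  Forest-graft : ∀ {r n xs} → Forest (r + m * k) n xs → Forest (suc r) (suc n) (graft xs)
  Forest-graft {r} {n} {xs} f@(l , _) =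
    Equivalence.from (Forest-node∷⇔ (length-chunks m xs) degrees)
      (subst (Forest (r + m * k) n) (sym (ungraft-graft xs)) f)
    where
    degrees : All (HasDegree k) (chunks m xs)
    degrees = chunks-hasDegree m xs (subst (m * k ≤_) (sym l) (m≤n+m (m * k) r))

  forests : ℕ → ℕ → List (List Tree)
  forests zero    zero    = [] ∷ []
  forests (suc n) zero    = []
  forests zero    (suc r) = map (leaf ∷_) (forests zero r)
  forests (suc n) (suc r) = map (leaf ∷_) (forests (suc n) r) ++ map graft (forests n (r + m * k))

  forests-sound : ∀ n r → All (Forest r n) (forests n r)
  forests-sound zero    zero    = (refl , [] , refl) ∷ []
  forests-sound (suc n) zero    = []
  forests-sound zero    (suc r) = gmap⁺ Forest-leaf∷ (forests-sound zero r)
  forests-sound (suc n) (suc r) =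
    ++⁺ (gmap⁺ Forest-leaf∷ (forests-sound (suc n) r))
        (gmap⁺ Forest-graft (forests-sound n (r + m * k)))

  leaf∷-∈-forests : ∀ n r {ts} → ts ∈ forests n r → leaf ∷ ts ∈ forests n (suc r)
  leaf∷-∈-forests zero    r ts∈ = ∈-map⁺ (leaf ∷_) ts∈
  leaf∷-∈-forests (suc n) r ts∈ = ∈-++⁺ˡ (∈-map⁺ (leaf ∷_) ts∈)

  graft-∈-forests : ∀ n r {ts} → ts ∈ forests n (r + m * k) → graft ts ∈ forests (suc n) (suc r)
  graft-∈-forests n r ts∈ = ∈-++⁺ʳ (map (leaf ∷_) (forests (suc n) r)) (∈-map⁺ graft ts∈)

  forests-complete : ∀ n r ts → Forest r n ts → ts ∈ forests n r
  forests-complete zero    zero    []      _            = here refl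
  forests-complete (suc n) zero    []      (_ , _ , ())
  forests-complete n       (suc r) []      (() , _)
  forests-complete n       zero    (_ ∷ _) (() , _)
  forests-complete n       (suc r) (node [] ∷ ts) (l , _ ∷ os , c) =
    leaf∷-∈-forests n r (forests-complete n r ts (suc-injective l , os , c))
  forests-complete n       (suc r) (node (_ ∷ _) ∷ ts) (_ , odd-node (inj₂ ()) _ ∷ _ , _)
  forests-complete zero    (suc r) (node cs@(_ ∷ _) ∷ ts) (_ , odd-node (inj₁ e) _ ∷ _ , c) =
    ⊥-elim (1+n≢0 (trans (sym (oddDegCountOs-node∷ m cs ts e)) c))
  forests-complete (suc n) (suc r) (node cs@(_ ∷ _) ∷ ts) f@(_ , odd-node (inj₁ e) evens ∷ _ , _) =
    subst (_∈ forests (suc n) (suc r)) (graft-ungraft cs ts e degrees)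
      (graft-∈-forests n r (forests-complete n (r + m * k) _ (Equivalence.to (Forest-node∷⇔ e degrees) f)))
    where
    degrees : All (HasDegree k) cs
    degrees = All.map EvenOK⇒HasDegree evens

  forests-unique : ∀ n r → Unique (forests n r)
  forests-unique zero    zero    = [] ∷ []
  forests-unique (suc n) zero    = []
  forests-unique zero    (suc r) = Unique.map⁺ ∷-injectiveʳ (forests-unique zero r)
  forests-unique (suc n) (suc r) =
    Unique.++⁺ (Unique.map⁺ ∷-injectiveʳ (forests-unique (suc n) r))
               (Unique.map⁺ graft-injective (forests-unique n (r + m * k)))
               leaf∷-≢-graft
    where
    leaf∷-≢-graft : ∀ {v} → v ∈ map (leaf ∷_) (forests (suc n) r) × v ∈ map graft (forests n (r + m * k)) → ⊥
    leaf∷-≢-graft (v∈ˡ , v∈ʳ) with ∈-map⁻ (leaf ∷_) v∈ˡ | ∈-map⁻ graft v∈ʳ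
    ... | _ , _ , refl | _ , _ , ()

  length-forests-zero : ∀ r → length (forests 0 r) ≡ 1
  length-forests-zero zero    = refl
  length-forests-zero (suc r) = trans (length-map (leaf ∷_) (forests 0 r)) (length-forests-zero r)

  length-forests-suc : ∀ n r →
    length (forests (suc n) (suc r)) ≡ length (forests (suc n) r) + length (forests n (r + m * k))
  length-forests-suc n r = begin
    length (map (leaf ∷_) (forests (suc n) r) ++ map graft (forests n (r + m * k)))
      ≡⟨ length-++ (map (leaf ∷_) (forests (suc n) r)) ⟩
    length (map (leaf ∷_) (forests (suc n) r)) + length (map graft (forests n (r + m * k)))
      ≡⟨ cong₂ _+_ (length-map (leaf ∷_) (forests (suc n) r)) (length-map graft (forests n (r + m * k))) ⟩
    length (forests (suc n) r) + length (forests n (r + m * k)) ∎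

node-injective : ∀ {cs ds} → node cs ≡ node ds → cs ≡ ds
node-injective refl = refl

theorem2p2 : (k m n : ℕ) → k ≥ 1 → m ≥ 1 →
    Σ (List Tree) (λ l →
      Unique l × ((t : Tree) → (IsKMTree k m n t ⇔ (t ∈ l))) ×
      (suc (m * n) * length l ≡ (suc (m * n) * k) C n))
theorem2p2 k@(suc k-1) (suc m-1) n _ _ =
  map node (forests n k) ,
  Unique.map⁺ node-injective (forests-unique n k) ,
  characterisation ,
  counted
  where
  open Forests k m-1
  open Raney (k-1 + m-1 * k) (λ n r → length (forests n r)) length-forests-zero (λ _ → refl) length-forests-suc

  characterisation : (t : Tree) → IsKMTree k m n t ⇔ t ∈ map node (forests n k)
  characterisation t = mk⇔ complete sound
    where
    complete : IsKMTree k m n t → t ∈ map node (forests n k)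
    complete (even-node l os , c) = ∈-map⁺ node (forests-complete n k _ (l , os , c))
    sound : t ∈ map node (forests n k) → IsKMTree k m n t
    sound t∈ with ∈-map⁻ node t∈
    ... | ts , ts∈ , refl with All.lookup (forests-sound n k) ts∈
    ...   | l , os , c = even-node l os , c

  counted : suc (m * n) * length (map node (forests n k)) ≡ (suc (m * n) * k) C n
  counted = *-cancelˡ-≡ _ _ k (begin
    k * (suc (m * n) * length (map node (forests n k)))
      ≡⟨ cong (λ x → k * (suc (m * n) * x)) (length-map node (forests n k)) ⟩
    k * (suc (m * n) * length (forests n k))
      ≡⟨ reorder m n k (length (forests n k)) ⟩
    (m * k * n + k) * length (forests n k)
      ≡⟨ raney n k ⟩
    k * ((m * k * n + k) C n)
      ≡⟨ cong (λ x → k * (x C n)) (expand m n k) ⟨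
    k * ((suc (m * n) * k) C n) ∎)
    where
    reorder : ∀ m n k l → k * (suc (m * n) * l) ≡ (m * k * n + k) * l
    reorder = solve-∀
    expand : ∀ m n k → suc (m * n) * k ≡ m * k * n + k
    expand = solve-∀
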